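{- Let $G$ be a finite connected simple graph. If $\operatorname{gon}(G)=\kappa(G)$, then $\operatorname{gon}(G)=\operatorname{mfgon}(G)$.
   Context: A vertex-cut of $G$ is a set $S\subset V(G)$ whose deletion leaves either a disconnected graph or a graph on one vertex; the vertex-connectivity $\kappa(G)$ is the minimum size of a vertex-cut. A divisor on $G$ is an integer combination $D=\sum_{v}D(v)(v)$ of vertices, with degree $\sum_v D(v)$; it is effective if all $D(v)\ge0$. Divisors are equivalent if their difference is in the integer column space of the Laplacian matrix (equivalently, they differ by chip-firing moves). The rank $r(D)$ is $-1$ if $D$ is not equivalent to an effective divisor, else the largest $r\ge0$ such that $D-E$ is equivalent to an effective divisor for every effective $E$ of degree $r$. $\operatorname{gon}(G)$ is the minimum degree of a divisor of positive rank; an effective divisor is multiplicity-free if $D(v)\le1$ for all $v$, and $\operatorname{mfgon}(G)$ is the minimum degree of a multiplicity-free divisor of positive rank. -}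

module Defs where

open import Data.Nat using (ℕ; zero; suc)
open import Data.Integer using (ℤ; +_; _+_; _-_; _*_; _≤_; 0ℤ; 1ℤ)
open import Data.Fin using (Fin; zero; suc)
open import Data.Fin.Subset using (Subset; _∉_; ∁; ∣_∣)
open import Data.Bool using (Bool; true; false)
open import Data.Unit using (⊤)
open import Data.Product using (Σ; _×_; ∃; ∃-syntax)
open import Data.Sum using (_⊎_)
open import Relation.Binary.PropositionalEquality using (_≡_)
open import Relation.Nullary using (¬_)

record Graph (n : ℕ) : Set where
  field
    adj    : Fin n → Fin n → Bool
    sym    : ∀ u v → adj u v ≡ adj v u
    irrefl : ∀ v → adj v v ≡ false
open Graph public

data Reach {n : ℕ} (G : Graph n) (P : Fin n → Set) : Fin n → Fin n → Set where
  here : ∀ {v} → P v → Reach G P v v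
  step : ∀ {u w v} → P u → adj G u w ≡ true → Reach G P w v → Reach G P u v

Connected : {n : ℕ} → Graph n → Set
Connected {n} G = (Σ (Fin n) (λ _ → ⊤)) × (∀ u v → Reach G (λ _ → ⊤) u v)

IsVertexCut : {n : ℕ} → Graph n → Subset n → Set
IsVertexCut G S =
  (∃[ u ] ∃[ v ] (u ∉ S × v ∉ S × ¬ Reach G (λ x → x ∉ S) u v))
  ⊎ (∣ ∁ S ∣ ≡ 1)

IsVertexConnectivity : {n : ℕ} → Graph n → ℕ → Set
IsVertexConnectivity G k =
  (∃[ S ] (IsVertexCut G S × ∣ S ∣ ≡ k))
  × (∀ S → IsVertexCut G S → k Data.Nat.≤ ∣ S ∣)

Divisor : ℕ → Set
Divisor n = Fin n → ℤ

sumℤ : {n : ℕ} → (Fin n → ℤ) → ℤ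
sumℤ {zero}  f = 0ℤ
sumℤ {suc n} f = f zero + sumℤ (λ i → f (suc i))

deg : {n : ℕ} → Divisor n → ℤ
deg = sumℤ

Effective : {n : ℕ} → Divisor n → Set
Effective D = ∀ v → 0ℤ ≤ D v

MultiplicityFree : {n : ℕ} → Divisor n → Set
MultiplicityFree D = Effective D × (∀ v → D v ≤ 1ℤ)

b2ℤ : Bool → ℤ
b2ℤ true  = 1ℤ
b2ℤ false = 0ℤ

-- Laplacian applied to an integer vector f: (L f)(v) = deg(v) f(v) - Σ_{u ~ v} f(u).
laplacian : {n : ℕ} → Graph n → (Fin n → ℤ) → Divisor n
laplacian G f v = sumℤ (λ u → b2ℤ (adj G v u) * (f v - f u))

_-ᴰ_ : {n : ℕ} → Divisor n → Divisor n → Divisor n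
(D -ᴰ E) v = D v - E v

Equivalent : {n : ℕ} → Graph n → Divisor n → Divisor n → Set
Equivalent G D D' = ∃[ f ] (∀ v → D v - D' v ≡ laplacian G f v)

EquivEffective : {n : ℕ} → Graph n → Divisor n → Set
EquivEffective G D = ∃[ D' ] (Equivalent G D D' × Effective D')

RankAtLeast : {n : ℕ} → Graph n → Divisor n → ℕ → Set
RankAtLeast G D r =
  EquivEffective G D ×
  (∀ E → Effective E → deg E ≡ + r → EquivEffective G (D -ᴰ E))

PositiveRank : {n : ℕ} → Graph n → Divisor n → Set
PositiveRank G D = ∃[ r ] (1 Data.Nat.≤ r × RankAtLeast G D r)

IsGon : {n : ℕ} → Graph n → ℤ → Set
IsGon G g =
  (∃[ D ] (PositiveRank G D × deg D ≡ g))
  × (∀ D → PositiveRank G D → g ≤ deg D)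

IsMfgon : {n : ℕ} → Graph n → ℤ → Set
IsMfgon G g =
  (∃[ D ] (MultiplicityFree D × PositiveRank G D × deg D ≡ g))
  × (∀ D → MultiplicityFree D → PositiveRank G D → g ≤ deg D)

module Submission where

-- Let D have positive rank and degree κ, and replace it by an equivalent effective D₀.
-- As κ < n, D₀ vanishes at some v; positive rank gives an effective D₁ ~ D₀ with
-- D₁(v) ≥ 1, say D₀ - D₁ = L F. Let X be the set where F is maximal. Every edge
-- leaving X takes a chip of D₀ at its end in X, so v ∉ X and the number e of edges
-- between X and its complement is at most κ. The vertices outside X adjacent to X
-- form a vertex cut unless they are the whole complement; if there are at least κ
-- of them, then e = κ, D₀ is exactly one chip per edge leaving X, and firing X
-- moves these chips across, onto κ distinct vertices. Otherwise the complement has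
-- c < κ vertices, each of degree ≥ κ and hence with ≥ κ - c + 1 neighbours in X,
-- so c (κ - c + 1) ≤ κ forces c = 1, and then D₀ itself is multiplicity-free.

open import Defs renaming (sym to adj-sym)

import Algebra.Properties.Semiring.Sum as SemiringSum
open import Data.Bool using (Bool; true; false; not)
open import Data.Bool.Properties using (¬-not; not-injective) renaming (_≟_ to _≟ᴮ_)
open import Data.Empty using (⊥-elim)
open import Data.Fin using (Fin; zero; suc)
open import Data.Fin.Properties using (any?) renaming (_≟_ to _≟ᶠ_)
open import Data.Fin.Subset using (_∉_; ∣_∣)
open import Data.Fin.Subset.Properties using (p⊂q⇒∣p∣<∣q∣; ⊆⊤; ∈⊤; ∣⊤∣≡n; ∣∁p∣≡n∸∣p∣)
open import Data.Integer using (ℤ; +_; _+_; _-_; _*_; -_; _≤_; _<_; 0ℤ; 1ℤ; -1ℤ; +≤+; +<+)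
open import Data.Integer.Properties
open import Data.Integer.Tactic.RingSolver using (solve-∀)
import Data.List.Extrema as Extrema
open import Data.List.Base using (allFin)
open import Data.List.Membership.Propositional.Properties using (∈-allFin)
import Data.List.Relation.Unary.All as All
open import Data.Nat using (ℕ)
import Data.Nat as ℕ
import Data.Nat.Properties as ℕ
open import Data.Product using (_,_; _×_; ∃-syntax)
open import Data.Sum using (inj₁; inj₂)
open import Data.Vec using (tabulate)
open import Data.Vec.Properties using (lookup∘tabulate; []=⇒lookup; lookup⇒[]=; tabulate-∘)
open import Function using (_∘_)
open import Relation.Binary.PropositionalEquality
  using (_≡_; refl; sym; trans; cong; cong₂; subst; subst₂; _≢_; _≗_; module ≡-Reasoning)
open import Relation.Nullary.Decidable using (does; dec-true; dec-false; yes; no; ¬?; _×-dec_)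

private
  module ∑ = SemiringSum +-*-semiring

sumℤ≡sum : ∀ {n} (f : Fin n → ℤ) → sumℤ f ≡ ∑.sum f
sumℤ≡sum {ℕ.zero}  f = refl
sumℤ≡sum {ℕ.suc n} f = cong (_+_ (f zero)) (sumℤ≡sum (f ∘ suc))

sumℤ-cong : ∀ {n} {f g : Fin n → ℤ} → f ≗ g → sumℤ f ≡ sumℤ g
sumℤ-cong {f = f} {g} f≗g =
  trans (sumℤ≡sum f) (trans (∑.sum-cong-≗ f≗g) (sym (sumℤ≡sum g)))

sumℤ-distrib-+ : ∀ {n} (f g : Fin n → ℤ) → sumℤ (λ i → f i + g i) ≡ sumℤ f + sumℤ g
sumℤ-distrib-+ f g = trans (sumℤ≡sum (λ i → f i + g i))
  (trans (∑.∑-distrib-+ f g) (sym (cong₂ _+_ (sumℤ≡sum f) (sumℤ≡sum g))))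

*-distribˡ-sumℤ : ∀ {n} c (f : Fin n → ℤ) → c * sumℤ f ≡ sumℤ (λ i → c * f i)
*-distribˡ-sumℤ c f = trans (cong (c *_) (sumℤ≡sum f))
  (trans (∑.*-distribˡ-sum c f) (sym (sumℤ≡sum (λ i → c * f i))))

sumℤ-comm : ∀ {m n} (f : Fin m → Fin n → ℤ) →
            sumℤ (λ i → sumℤ (f i)) ≡ sumℤ (λ j → sumℤ (λ i → f i j))
sumℤ-comm f = trans (double f) (trans (∑.∑-comm f) (sym (double (λ j i → f i j))))
  where
  double : ∀ {m n} (h : Fin m → Fin n → ℤ) → sumℤ (λ i → sumℤ (h i)) ≡ ∑.sum (λ i → ∑.sum (h i))
  double h = trans (sumℤ-cong (λ i → sumℤ≡sum (h i))) (sumℤ≡sum (λ i → ∑.sum (h i)))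

sumℤ-neg : ∀ {n} (f : Fin n → ℤ) → sumℤ (λ i → - f i) ≡ - sumℤ f
sumℤ-neg f = begin
  sumℤ (λ i → - f i)       ≡⟨ sumℤ-cong (λ i → sym (-1*i≡-i (f i))) ⟩
  sumℤ (λ i → -1ℤ * f i)   ≡⟨ sym (*-distribˡ-sumℤ -1ℤ f) ⟩
  -1ℤ * sumℤ f             ≡⟨ -1*i≡-i (sumℤ f) ⟩
  - sumℤ f                 ∎
  where open ≡-Reasoning

sumℤ-distrib-- : ∀ {n} (f g : Fin n → ℤ) → sumℤ (λ i → f i - g i) ≡ sumℤ f - sumℤ g
sumℤ-distrib-- f g = trans (sumℤ-distrib-+ f (λ i → - g i)) (cong (_+_ (sumℤ f)) (sumℤ-neg g))

sumℤ-zero : ∀ {n} → sumℤ {n} (λ _ → 0ℤ) ≡ 0ℤ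
sumℤ-zero {n} = trans (sumℤ≡sum {n} (λ _ → 0ℤ)) (∑.sum-replicate-zero n)

sumℤ-one : ∀ {n} → sumℤ {n} (λ _ → 1ℤ) ≡ + n
sumℤ-one {ℕ.zero}  = refl
sumℤ-one {ℕ.suc n} = cong (_+_ 1ℤ) (sumℤ-one {n})

sumℤ-mono-≤ : ∀ {n} {f g : Fin n → ℤ} → (∀ i → f i ≤ g i) → sumℤ f ≤ sumℤ g
sumℤ-mono-≤ {ℕ.zero}  f≤g = ≤-refl
sumℤ-mono-≤ {ℕ.suc n} f≤g = +-mono-≤ (f≤g zero) (sumℤ-mono-≤ (f≤g ∘ suc))

i+j-j≡i : ∀ i j → i + j - j ≡ i
i+j-j≡i = solve-∀

+-cancelʳ-≤ : ∀ {i j} k → i + k ≤ j + k → i ≤ j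
+-cancelʳ-≤ {i} {j} k p = subst₂ _≤_ (i+j-j≡i i k) (i+j-j≡i j k) (+-monoˡ-≤ (- k) p)

+-cancelˡ-≤ : ∀ i {j k} → i + j ≤ i + k → j ≤ k
+-cancelˡ-≤ i {j} {k} p = +-cancelʳ-≤ i (subst₂ _≤_ (+-comm i j) (+-comm i k) p)

sumℤ-tight : ∀ {n} {f g : Fin n → ℤ} → (∀ i → f i ≤ g i) → sumℤ g ≤ sumℤ f → f ≗ g
sumℤ-tight {ℕ.suc n} {f} {g} f≤g Σg≤Σf zero = ≤-antisym (f≤g zero)
  (+-cancelʳ-≤ _ (≤-trans Σg≤Σf (+-monoʳ-≤ (f zero) (sumℤ-mono-≤ (f≤g ∘ suc)))))
sumℤ-tight {ℕ.suc n} {f} {g} f≤g Σg≤Σf (suc i) = sumℤ-tight (f≤g ∘ suc)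
  (+-cancelˡ-≤ (g zero) (≤-trans Σg≤Σf (+-monoˡ-≤ _ (f≤g zero)))) i

sumℤ-nonNeg : ∀ {n} {f : Fin n → ℤ} → (∀ i → 0ℤ ≤ f i) → 0ℤ ≤ sumℤ f
sumℤ-nonNeg {n} {f} f≥0 = subst (_≤ sumℤ f) (sumℤ-zero {n}) (sumℤ-mono-≤ f≥0)

term≤sumℤ : ∀ {n} {f : Fin n → ℤ} → (∀ i → 0ℤ ≤ f i) → ∀ i → f i ≤ sumℤ f
term≤sumℤ {f = f} f≥0 zero =
  subst (_≤ sumℤ f) (+-identityʳ (f zero)) (+-monoʳ-≤ (f zero) (sumℤ-nonNeg (f≥0 ∘ suc)))
term≤sumℤ {f = f} f≥0 (suc i) = ≤-trans (term≤sumℤ (f≥0 ∘ suc) i)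
  (subst (_≤ sumℤ f) (+-identityˡ (sumℤ (f ∘ suc))) (+-monoˡ-≤ (sumℤ (f ∘ suc)) (f≥0 zero)))

δ : ∀ {n} → Fin n → Fin n → ℤ
δ w u = b2ℤ (does (u ≟ᶠ w))

sumℤ-δ : ∀ {n} (w : Fin n) → sumℤ (δ w) ≡ 1ℤ
sumℤ-δ {ℕ.suc n} zero    = cong (_+_ 1ℤ) (sumℤ-zero {n})
sumℤ-δ {ℕ.suc n} (suc w) = trans (+-identityˡ (sumℤ (δ w))) (sumℤ-δ w)

b2ℤ-not : ∀ b → b2ℤ (not b) ≡ 1ℤ - b2ℤ b
b2ℤ-not true  = refl
b2ℤ-not false = refl

b2ℤ-nonNeg : ∀ b → 0ℤ ≤ b2ℤ b
b2ℤ-nonNeg true  = +≤+ ℕ.z≤n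
b2ℤ-nonNeg false = ≤-refl

b2ℤ-≤1 : ∀ b → b2ℤ b ≤ 1ℤ
b2ℤ-≤1 true  = ≤-refl
b2ℤ-≤1 false = +≤+ ℕ.z≤n

b2ℤ*-mono-≤ : ∀ b {x y} → x ≤ y → b2ℤ b * x ≤ b2ℤ b * y
b2ℤ*-mono-≤ true  {x} {y} x≤y = subst₂ _≤_ (sym (*-identityˡ x)) (sym (*-identityˡ y)) x≤y
b2ℤ*-mono-≤ false x≤y = ≤-refl

b2ℤ*-mono-≤-if : ∀ b {x y} → (b ≡ true → x ≤ y) → b2ℤ b * x ≤ b2ℤ b * y
b2ℤ*-mono-≤-if true  x≤y = b2ℤ*-mono-≤ true (x≤y refl)
b2ℤ*-mono-≤-if false _   = ≤-refl

b2ℤ*-≤-if : ∀ b {y z} → 0ℤ ≤ z → (b ≡ true → y ≤ z) → b2ℤ b * y ≤ z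
b2ℤ*-≤-if true  {y} _ y≤z = subst (_≤ _) (sym (*-identityˡ y)) (y≤z refl)
b2ℤ*-≤-if false 0≤z _     = 0≤z

b2ℤ*-nonNeg : ∀ b {x} → 0ℤ ≤ x → 0ℤ ≤ b2ℤ b * x
b2ℤ*-nonNeg b {x} 0≤x = subst (_≤ b2ℤ b * x) (*-zeroʳ (b2ℤ b)) (b2ℤ*-mono-≤ b 0≤x)

b2ℤ*-≤ : ∀ b {x} → 0ℤ ≤ x → b2ℤ b * x ≤ x
b2ℤ*-≤ true  {x} _   = ≤-reflexive (*-identityˡ x)
b2ℤ*-≤ false     0≤x = 0≤x

i*j≤0⇒i≡0 : ∀ {i j} → 0ℤ ≤ i → 1ℤ ≤ j → i * j ≤ 0ℤ → i ≡ 0ℤ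
i*j≤0⇒i≡0 {+ m} {j} _ 1≤j ij≤0 = ≤-antisym
  (≤-trans (≤-reflexive (sym (*-identityʳ (+ m)))) (≤-trans (*-monoˡ-≤-nonNeg (+ m) 1≤j) ij≤0))
  (+≤+ ℕ.z≤n)

true≢false : true ≢ false
true≢false ()

𝟙 : ∀ {n} → (Fin n → Bool) → Fin n → ℤ
𝟙 X u = b2ℤ (X u)

_⊆ᵇ_ : ∀ {n} → (Fin n → Bool) → (Fin n → Bool) → Set
P ⊆ᵇ Q = ∀ {w} → P w ≡ true → Q w ≡ true

𝟙-mono : ∀ {n} {P Q : Fin n → Bool} → P ⊆ᵇ Q → ∀ w → 𝟙 P w ≤ 𝟙 Q w
𝟙-mono {P = P} {Q} P⊆Q w with P w in Pw
... | true  = ≤-reflexive (cong b2ℤ (sym (P⊆Q Pw)))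
... | false = b2ℤ-nonNeg (Q w)

card-tabulate : ∀ {n} (X : Fin n → Bool) → + ∣ tabulate X ∣ ≡ sumℤ (𝟙 X)
card-tabulate {ℕ.zero}  X = refl
card-tabulate {ℕ.suc n} X with X zero
... | true  = cong (_+_ 1ℤ) (card-tabulate (X ∘ suc))
... | false = trans (card-tabulate (X ∘ suc)) (sym (+-identityˡ _))

support : ∀ {n} → Divisor n → Fin n → Bool
support D v = does (0ℤ <? D v)

support-≥1 : ∀ {n} {D : Divisor n} {v} → 1ℤ ≤ D v → support D v ≡ true
support-≥1 {D = D} {v} 1≤Dv = dec-true (0ℤ <? D v) (suc[i]≤j⇒i<j 1≤Dv)

support-0 : ∀ {n} {D : Divisor n} {v} → D v ≡ 0ℤ → support D v ≡ false
support-0 Dv≡0 = cong (λ d → does (0ℤ <? d)) Dv≡0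

𝟙support≤ : ∀ {n} {D : Divisor n} → Effective D → ∀ v → 𝟙 (support D) v ≤ D v
𝟙support≤ {D = D} D≥0 v with 0ℤ <? D v
... | yes 0<Dv = i<j⇒suc[i]≤j 0<Dv
... | no  _    = D≥0 v

card-support≤deg : ∀ {n} {D : Divisor n} → Effective D → sumℤ (𝟙 (support D)) ≤ deg D
card-support≤deg D≥0 = sumℤ-mono-≤ (𝟙support≤ D≥0)

deg≤card-support⇒multiplicityFree : ∀ {n} {D : Divisor n} → Effective D →
  deg D ≤ sumℤ (𝟙 (support D)) → MultiplicityFree D
deg≤card-support⇒multiplicityFree {D = D} D≥0 deg≤card =
  D≥0 , λ v → subst (_≤ 1ℤ) (sumℤ-tight (𝟙support≤ D≥0) deg≤card v) (b2ℤ-≤1 (support D v))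

module Laplacian {n : ℕ} (G : Graph n) where

  A : Fin n → Fin n → ℤ
  A u w = b2ℤ (adj G u w)

  laplacian-+ : ∀ f g v → laplacian G (λ u → f u + g u) v ≡ laplacian G f v + laplacian G g v
  laplacian-+ f g v = trans (sumℤ-cong λ u → distrib (A v u) (f v) (f u) (g v) (g u))
                            (sumℤ-distrib-+ (λ u → A v u * (f v - f u)) (λ u → A v u * (g v - g u)))
    where
    distrib : ∀ a x y x′ y′ → a * ((x + x′) - (y + y′)) ≡ a * (x - y) + a * (x′ - y′)
    distrib = solve-∀

  laplacian-neg : ∀ f v → laplacian G (λ u → - f u) v ≡ - laplacian G f v
  laplacian-neg f v = trans (sumℤ-cong λ u → distrib (A v u) (f v) (f u))
                            (sumℤ-neg (λ u → A v u * (f v - f u)))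
    where
    distrib : ∀ a x y → a * (- x - - y) ≡ - (a * (x - y))
    distrib = solve-∀

  laplacian-zero : ∀ v → laplacian G (λ _ → 0ℤ) v ≡ 0ℤ
  laplacian-zero v = trans (sumℤ-cong λ u → *-zeroʳ (A v u)) (sumℤ-zero {n})

  deg-laplacian : ∀ f → deg (laplacian G f) ≡ 0ℤ
  deg-laplacian f = begin
    sumℤ (λ v → sumℤ (λ u → A v u * (f v - f u)))
      ≡⟨ sumℤ-cong (λ v → trans (sumℤ-cong λ u → distrib (A v u) (f v) (f u))
                                (sumℤ-distrib-- (λ u → A v u * f v) (λ u → A v u * f u))) ⟩
    sumℤ (λ v → sumℤ (λ u → A v u * f v) - sumℤ (λ u → A v u * f u))
      ≡⟨ sumℤ-distrib-- (λ v → sumℤ (λ u → A v u * f v)) (λ v → sumℤ (λ u → A v u * f u)) ⟩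
    S - sumℤ (λ v → sumℤ (λ u → A v u * f u))
      ≡⟨ cong (_-_ S) (trans (sumℤ-comm (λ v u → A v u * f u))
                            (sumℤ-cong λ u → sumℤ-cong λ v → cong (_* f u) (A-sym v u))) ⟩
    S - S
      ≡⟨ +-inverseʳ S ⟩
    0ℤ ∎
    where
    open ≡-Reasoning
    S : ℤ
    S = sumℤ (λ v → sumℤ (λ u → A v u * f v))
    distrib : ∀ a x y → a * (x - y) ≡ a * x - a * y
    distrib = solve-∀
    A-sym : ∀ v u → A v u ≡ A u v
    A-sym v u = cong b2ℤ (adj-sym G v u)

  ~-refl : ∀ D → Equivalent G D D
  ~-refl D = (λ _ → 0ℤ) , λ v → trans (+-inverseʳ (D v)) (sym (laplacian-zero v))

  ~-sym : ∀ {D D′} → Equivalent G D D′ → Equivalent G D′ D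
  ~-sym {D} {D′} (f , D-D′≡Lf) = (λ u → - f u) , λ v → begin
    D′ v - D v           ≡⟨ swap (D v) (D′ v) ⟩
    - (D v - D′ v)       ≡⟨ cong -_ (D-D′≡Lf v) ⟩
    - laplacian G f v    ≡⟨ sym (laplacian-neg f v) ⟩
    laplacian G (λ u → - f u) v ∎
    where
    open ≡-Reasoning
    swap : ∀ x y → y - x ≡ - (x - y)
    swap = solve-∀

  ~-trans : ∀ {D D′ D″} → Equivalent G D D′ → Equivalent G D′ D″ → Equivalent G D D″
  ~-trans {D} {D′} {D″} (f , D-D′≡Lf) (g , D′-D″≡Lg) = (λ u → f u + g u) , λ v → begin
    D v - D″ v                          ≡⟨ sym (+-minus-telescope (D v) (D′ v) (D″ v)) ⟩
    (D v - D′ v) + (D′ v - D″ v)        ≡⟨ cong₂ _+_ (D-D′≡Lf v) (D′-D″≡Lg v) ⟩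
    laplacian G f v + laplacian G g v   ≡⟨ sym (laplacian-+ f g v) ⟩
    laplacian G (λ u → f u + g u) v ∎
    where open ≡-Reasoning

  ~-shift : ∀ {D D′} E → Equivalent G D D′ → Equivalent G (D -ᴰ E) (D′ -ᴰ E)
  ~-shift {D} {D′} E (f , D-D′≡Lf) = f , λ v → trans (cancel (D v) (D′ v) (E v)) (D-D′≡Lf v)
    where
    cancel : ∀ x y z → (x - z) - (y - z) ≡ x - y
    cancel = solve-∀

  deg-~ : ∀ {D D′} → Equivalent G D D′ → deg D ≡ deg D′
  deg-~ {D} {D′} (f , D-D′≡Lf) = i-j≡0⇒i≡j (deg D) (deg D′) (begin
    deg D - deg D′             ≡⟨ sym (sumℤ-distrib-- D D′) ⟩
    sumℤ (λ v → D v - D′ v)    ≡⟨ sumℤ-cong D-D′≡Lf ⟩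
    deg (laplacian G f)        ≡⟨ deg-laplacian f ⟩
    0ℤ ∎)
    where open ≡-Reasoning

  positiveRank-~ : ∀ {D D′} → Equivalent G D D′ → PositiveRank G D → PositiveRank G D′
  positiveRank-~ {D} {D′} D~D′ (r , 1≤r , (D₀ , D~D₀ , D₀≥0) , rank≥r) =
    r , 1≤r , (D₀ , ~-trans {D′} {D} {D₀} (~-sym {D} {D′} D~D′) D~D₀ , D₀≥0) , λ E E≥0 degE →
      let (Dₑ , D-E~Dₑ , Dₑ≥0) = rank≥r E E≥0 degE
          D′-E~D-E = ~-sym {D -ᴰ E} {D′ -ᴰ E} (~-shift {D} {D′} E D~D′)
      in Dₑ , ~-trans {D′ -ᴰ E} {D -ᴰ E} {Dₑ} D′-E~D-E D-E~Dₑ , Dₑ≥0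

  positiveRank⇒~chip-at : ∀ {D} → PositiveRank G D → ∀ v →
    ∃[ D′ ] (Effective D′ × 1ℤ ≤ D′ v × Equivalent G D D′)
  positiveRank⇒~chip-at {D} (r , 1≤r , _ , rank≥r) v = add-back (rank≥r E E≥0 degE)
    where
    E : Divisor n
    E u = + r * δ v u
    E≥0 : Effective E
    E≥0 u = subst (0ℤ ≤_) (*-comm (δ v u) (+ r)) (b2ℤ*-nonNeg (does (u ≟ᶠ v)) (+≤+ ℕ.z≤n))
    degE : deg E ≡ + r
    degE = trans (sym (*-distribˡ-sumℤ (+ r) (δ v)))
                 (trans (cong (_*_ (+ r)) (sumℤ-δ v)) (*-identityʳ (+ r)))
    Ev≡r : E v ≡ + r
    Ev≡r = trans (cong (λ b → + r * b2ℤ b) (dec-true (v ≟ᶠ v) refl)) (*-identityʳ (+ r))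
    regroup : ∀ d e dₑ → d - (dₑ + e) ≡ (d - e) - dₑ
    regroup = solve-∀
    add-back : EquivEffective G (D -ᴰ E) → ∃[ D′ ] (Effective D′ × 1ℤ ≤ D′ v × Equivalent G D D′)
    add-back (Dₑ , (f , D-E-Dₑ≡Lf) , Dₑ≥0) =
      (λ u → Dₑ u + E u) ,
      (λ u → +-mono-≤ (Dₑ≥0 u) (E≥0 u)) ,
      +-mono-≤ (Dₑ≥0 v) (≤-trans (+≤+ 1≤r) (≤-reflexive (sym Ev≡r))) ,
      (f , λ u → trans (regroup (D u) (E u) (Dₑ u)) (D-E-Dₑ≡Lf u))

  neighboursIn : (Fin n → Bool) → Fin n → ℤ
  neighboursIn Y u = sumℤ (λ w → A u w * 𝟙 Y w)

  neighboursIn-nonNeg : ∀ Y u → 0ℤ ≤ neighboursIn Y u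
  neighboursIn-nonNeg Y u = sumℤ-nonNeg (λ w → b2ℤ*-nonNeg (adj G u w) (b2ℤ-nonNeg (Y w)))

  neighboursIn-≥1 : ∀ {Y u x} → Y x ≡ true → adj G u x ≡ true → 1ℤ ≤ neighboursIn Y u
  neighboursIn-≥1 {Y} {u} {x} Yx u~x =
    subst (_≤ neighboursIn Y u) (cong₂ (λ a y → b2ℤ a * b2ℤ y) u~x Yx)
      (term≤sumℤ (λ w → b2ℤ*-nonNeg (adj G u w) (b2ℤ-nonNeg (Y w))) x)

  neighboursIn-≤card : ∀ Y u → neighboursIn Y u ≤ sumℤ (𝟙 Y)
  neighboursIn-≤card Y u = sumℤ-mono-≤ (λ w → b2ℤ*-≤ (adj G u w) (b2ℤ-nonNeg (Y w)))

  neighboursIn-<card : ∀ {Y w} → Y w ≡ true → neighboursIn Y w + 1ℤ ≤ sumℤ (𝟙 Y)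
  neighboursIn-<card {Y} {w} Yw = begin
    neighboursIn Y w + 1ℤ               ≡⟨ cong (_+_ (neighboursIn Y w)) (sym (sumℤ-δ w)) ⟩
    neighboursIn Y w + sumℤ (δ w)       ≡⟨ sym (sumℤ-distrib-+ (λ u → A w u * 𝟙 Y u) (δ w)) ⟩
    sumℤ (λ u → A w u * 𝟙 Y u + δ w u)  ≤⟨ sumℤ-mono-≤ term≤ ⟩
    sumℤ (𝟙 Y)                          ∎
    where
    open ≤-Reasoning
    term≤ : ∀ u → A w u * 𝟙 Y u + δ w u ≤ 𝟙 Y u
    term≤ u with u ≟ᶠ w
    ... | yes refl rewrite irrefl G u | Yw = ≤-refl
    ... | no _ = subst (_≤ 𝟙 Y u) (sym (+-identityʳ _)) (b2ℤ*-≤ (adj G w u) (b2ℤ-nonNeg (Y u)))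

  degree-split : ∀ Y u → sumℤ (A u) ≡ neighboursIn Y u + neighboursIn (not ∘ Y) u
  degree-split Y u = trans (sumℤ-cong λ w → split (A u w) (Y w))
    (sumℤ-distrib-+ (λ w → A u w * 𝟙 Y w) (λ w → A u w * 𝟙 (not ∘ Y) w))
    where
    ring : ∀ a y → a ≡ a * y + a * (1ℤ - y)
    ring = solve-∀
    split : ∀ a b → a ≡ a * b2ℤ b + a * b2ℤ (not b)
    split a b rewrite b2ℤ-not b = ring a (b2ℤ b)

  -- Firing X removes innerBoundary X and adds outerBoundary X (laplacian-𝟙): both
  -- place one chip per edge leaving X, at its end inside resp. outside X.
  innerBoundary outerBoundary : (Fin n → Bool) → Divisor n
  innerBoundary X u = 𝟙 X u * neighboursIn (not ∘ X) u
  outerBoundary X u = 𝟙 (not ∘ X) u * neighboursIn X u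

  outerBoundary-effective : ∀ X → Effective (outerBoundary X)
  outerBoundary-effective X u = b2ℤ*-nonNeg (not (X u)) (neighboursIn-nonNeg X u)

  outerBoundary-≥1 : ∀ {X x y} → X y ≡ false → X x ≡ true → adj G y x ≡ true →
                     1ℤ ≤ outerBoundary X y
  outerBoundary-≥1 {X} {x} {y} Xy Xx y~x =
    subst (1ℤ ≤_) (trans (sym (*-identityˡ _)) (cong (λ b → b2ℤ (not b) * neighboursIn X y) (sym Xy)))
          (neighboursIn-≥1 Xx y~x)

  laplacian-𝟙 : ∀ X u → laplacian G (𝟙 X) u ≡ innerBoundary X u - outerBoundary X u
  laplacian-𝟙 X u = begin
    sumℤ (λ w → A u w * (x u - x w))
      ≡⟨ sumℤ-cong (λ w → split (A u w) (X u) (X w)) ⟩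
    sumℤ (λ w → x u * (A u w * x̄ w) - x̄ u * (A u w * x w))
      ≡⟨ sumℤ-distrib-- (λ w → x u * (A u w * x̄ w)) (λ w → x̄ u * (A u w * x w)) ⟩
    sumℤ (λ w → x u * (A u w * x̄ w)) - sumℤ (λ w → x̄ u * (A u w * x w))
      ≡⟨ sym (cong₂ _-_ (*-distribˡ-sumℤ (x u) (λ w → A u w * x̄ w))
                        (*-distribˡ-sumℤ (x̄ u) (λ w → A u w * x w))) ⟩
    innerBoundary X u - outerBoundary X u ∎
    where
    open ≡-Reasoning
    x x̄ : Fin n → ℤ
    x = 𝟙 X
    x̄ = 𝟙 (not ∘ X)
    ring : ∀ a y z → a * (y - z) ≡ y * (a * (1ℤ - z)) - (1ℤ - y) * (a * z)
    ring = solve-∀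
    split : ∀ a b c → a * (b2ℤ b - b2ℤ c) ≡ b2ℤ b * (a * b2ℤ (not c)) - b2ℤ (not b) * (a * b2ℤ c)
    split a b c rewrite b2ℤ-not b | b2ℤ-not c = ring a (b2ℤ b) (b2ℤ c)

  innerBoundary~outerBoundary : ∀ X → Equivalent G (innerBoundary X) (outerBoundary X)
  innerBoundary~outerBoundary X = 𝟙 X , λ u → sym (laplacian-𝟙 X u)

∉-tabulate⁺ : ∀ {n} {P : Fin n → Bool} {x} → P x ≡ false → x ∉ tabulate P
∉-tabulate⁺ {P = P} {x} Px≡false x∈P =
  true≢false (trans (sym ([]=⇒lookup x∈P)) (trans (lookup∘tabulate P x) Px≡false))

∉-tabulate⁻ : ∀ {n} {P : Fin n → Bool} {x} → x ∉ tabulate P → P x ≡ false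
∉-tabulate⁻ {P = P} {x} x∉P with P x in Px
... | true  = ⊥-elim (x∉P (lookup⇒[]= x (tabulate P) (trans (lookup∘tabulate P x) Px)))
... | false = refl

reach-source : ∀ {n} {G : Graph n} {P : Fin n → Set} {u v} → Reach G P u v → P u
reach-source (here Pu)     = Pu
reach-source (step Pu _ _) = Pu

module Connectivity {n : ℕ} (G : Graph n) {k : ℕ}
                    (κ≤cut : ∀ S → IsVertexCut G S → k ℕ.≤ ∣ S ∣) where

  open Laplacian G using (A)

  Enclosed : (X P : Fin n → Bool) → Set
  Enclosed X P = ∀ {x y} → X x ≡ true → adj G x y ≡ true → P y ≡ false → X y ≡ true

  reach-enclosed : ∀ {X P x w} → Enclosed X P →
                   Reach G (_∉ tabulate P) x w → X x ≡ true → X w ≡ true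
  reach-enclosed enc (here _)             Xx = Xx
  reach-enclosed enc (step _ x~y y⇝w) Xx =
    reach-enclosed enc y⇝w (enc Xx x~y (∉-tabulate⁻ (reach-source y⇝w)))

  κ≤separator : ∀ {X P x w} → Enclosed X P → X x ≡ true → P x ≡ false →
                X w ≡ false → P w ≡ false → + k ≤ sumℤ (𝟙 P)
  κ≤separator {X} {P} {x} {w} enc Xx Px Xw Pw =
    subst (+ k ≤_) (card-tabulate P) (+≤+ (κ≤cut (tabulate P) (inj₁
      (x , w , ∉-tabulate⁺ Px , ∉-tabulate⁺ Pw ,
       λ x⇝w → true≢false (trans (sym (reach-enclosed enc x⇝w Xx)) Xw)))))

  κ≤degree : ∀ a → + k ≤ sumℤ (A a)
  κ≤degree a with any? (λ w → ¬? (w ≟ᶠ a) ×-dec (adj G a w ≟ᴮ false))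
  ... | yes (w , w≢a , a≁w) =
    κ≤separator {X = λ u → does (u ≟ᶠ a)} {P = adj G a} enc
                (dec-true (a ≟ᶠ a) refl) (irrefl G a) (dec-false (w ≟ᶠ a) w≢a) a≁w
    where
    enc : Enclosed (λ u → does (u ≟ᶠ a)) (adj G a)
    enc {x} Xx x~y a≁y with x ≟ᶠ a
    ... | yes refl = ⊥-elim (true≢false (trans (sym x~y) a≁y))
  -- a is adjacent to every other vertex, so deleting its neighbours leaves one vertex
  ... | no ∄w = subst (+ k ≤_) (card-tabulate (adj G a)) (+≤+ (κ≤cut (tabulate (adj G a))
                  (inj₂ (+-injective (trans (cong (+_ ∘ ∣_∣) (sym (tabulate-∘ not (adj G a))))
                                     (trans (card-tabulate (not ∘ adj G a))
                                     (trans (sumℤ-cong non-neighbour≡δ) (sumℤ-δ a))))))))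
    where
    non-neighbour≡δ : 𝟙 (not ∘ adj G a) ≗ δ a
    non-neighbour≡δ w with w ≟ᶠ a | adj G a w in a~w
    ... | yes refl | _     = cong (b2ℤ ∘ not) (trans (sym a~w) (irrefl G a))
    ... | no w≢a   | true  = refl
    ... | no w≢a   | false = ⊥-elim (∄w (w , w≢a , a~w))

i<j⇒1≤j-i : ∀ {i j} → i < j → 1ℤ ≤ j - i
i<j⇒1≤j-i {i} {j} i<j = 0≤i-j⇒j≤i (subst (0ℤ ≤_) (regroup j i) (i≤j⇒0≤j-i (i<j⇒suc[i]≤j i<j)))
  where
  regroup : ∀ j i → j - (1ℤ + i) ≡ j - i - 1ℤ
  regroup = solve-∀

module MaxLevelSet {n : ℕ} (G : Graph n) {D₀ D₁ : Divisor n}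
                   (D₀≥0 : Effective D₀) (D₁≥0 : Effective D₁)
                   (F : Fin n → ℤ) (D₀-D₁≡LF : ∀ u → D₀ u - D₁ u ≡ laplacian G F u)
                   (u₀ : Fin n) where

  open Laplacian G
  open Extrema ≤-totalOrder using (argmax; f[xs]≤f[argmax])

  top : Fin n
  top = argmax F u₀ (allFin n)

  F≤F[top] : ∀ u → F u ≤ F top
  F≤F[top] u = All.lookup (f[xs]≤f[argmax] {f = F} u₀ (allFin n)) (∈-allFin u)

  Top : Fin n → Bool
  Top u = does (F u ≟ F top)

  top∈Top : Top top ≡ true
  top∈Top = dec-true (F top ≟ F top) refl

  𝟙[not-Top]≤F[top]-F : ∀ u → 𝟙 (not ∘ Top) u ≤ F top - F u
  𝟙[not-Top]≤F[top]-F u with F u ≟ F top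
  ... | yes _    = i≤j⇒0≤j-i (F≤F[top] u)
  ... | no  Fu≢ = i<j⇒1≤j-i (≤∧≢⇒< (F≤F[top] u) Fu≢)

  neighboursOutside≤laplacian : ∀ {u} → Top u ≡ true → neighboursIn (not ∘ Top) u ≤ laplacian G F u
  neighboursOutside≤laplacian {u} Tu = sumℤ-mono-≤ λ w →
    b2ℤ*-mono-≤ (adj G u w)
      (subst (λ m → 𝟙 (not ∘ Top) w ≤ m - F w) (sym (on-top Tu)) (𝟙[not-Top]≤F[top]-F w))
    where
    on-top : ∀ {u} → Top u ≡ true → F u ≡ F top
    on-top {u} Tu with F u ≟ F top
    ... | yes Fu≡ = Fu≡

  innerBoundary≤D₀ : ∀ u → innerBoundary Top u ≤ D₀ u
  innerBoundary≤D₀ u = b2ℤ*-≤-if (Top u) (D₀≥0 u) λ Tu → begin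
    neighboursIn (not ∘ Top) u   ≤⟨ neighboursOutside≤laplacian Tu ⟩
    laplacian G F u              ≡⟨ sym (D₀-D₁≡LF u) ⟩
    D₀ u - D₁ u                  ≤⟨ +-monoʳ-≤ (D₀ u) (neg-mono-≤ (D₁≥0 u)) ⟩
    D₀ u + 0ℤ                    ≡⟨ +-identityʳ (D₀ u) ⟩
    D₀ u                         ∎
    where open ≤-Reasoning

  outside-Top : ∀ {v} → D₀ v ≡ 0ℤ → 1ℤ ≤ D₁ v → Top v ≡ false
  outside-Top {v} D₀v≡0 1≤D₁v = ¬-not λ Tv → <⇒≱ LFv<0 (≤-trans (neighboursIn-nonNeg (not ∘ Top) v)
                                                        (neighboursOutside≤laplacian Tv))
    where
    LFv<0 : laplacian G F v < 0ℤ
    LFv<0 = subst (_< 0ℤ)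
      (trans (sym (+-identityˡ (- D₁ v))) (trans (cong (_- D₁ v) (sym D₀v≡0)) (D₀-D₁≡LF v)))
      (neg-mono-< (suc[i]≤j⇒i<j {0ℤ} 1≤D₁v))

MultiplicityFreeRepresentative : ∀ {n} → Graph n → Divisor n → Set
MultiplicityFreeRepresentative G D = ∃[ D′ ] (MultiplicityFree D′ × Equivalent G D D′)

module BoundedFiringSet {n : ℕ} (G : Graph n) {k : ℕ}
            (κ≤cut : ∀ S → IsVertexCut G S → k ℕ.≤ ∣ S ∣)
            {D : Divisor n} (D≥0 : Effective D) (degD≡k : deg D ≡ + k)
            (X : Fin n → Bool) {x v : Fin n} (x∈X : X x ≡ true) (v∉X : X v ≡ false)
            (inner≤D : ∀ u → Laplacian.innerBoundary G X u ≤ D u) where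

  open Laplacian G
  open Connectivity G κ≤cut

  e : ℤ
  e = deg (innerBoundary X)

  deg-outer≡e : deg (outerBoundary X) ≡ e
  deg-outer≡e = sym (deg-~ {innerBoundary X} {outerBoundary X} (innerBoundary~outerBoundary X))

  e≤k : e ≤ + k
  e≤k = subst (e ≤_) degD≡k (sumℤ-mono-≤ inner≤D)

  D≗inner : + k ≤ e → D ≗ innerBoundary X
  D≗inner k≤e u = sym (sumℤ-tight inner≤D (subst (_≤ e) (sym degD≡k) k≤e) u)

  D~outer : + k ≤ e → Equivalent G D (outerBoundary X)
  D~outer k≤e = 𝟙 X , λ u →
    trans (cong (_- outerBoundary X u) (D≗inner k≤e u)) (sym (laplacian-𝟙 X u))

  N : ℤ
  N = sumℤ (𝟙 (support (outerBoundary X)))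

  N≤e : N ≤ e
  N≤e = subst (N ≤_) deg-outer≡e (card-support≤deg (outerBoundary-effective X))

  enclosed : Enclosed X (support (outerBoundary X))
  enclosed {x} {y} Xx x~y y∉N = ¬-not λ Xy →
    true≢false (trans (sym (support-≥1 {D = outerBoundary X} (1≤outer Xy))) y∉N)
    where
    1≤outer : X y ≡ false → 1ℤ ≤ outerBoundary X y
    1≤outer Xy = outerBoundary-≥1 Xy Xx (trans (adj-sym G y x) x~y)

  via-outer : + k ≤ N → MultiplicityFreeRepresentative G D
  via-outer k≤N =
    outerBoundary X ,
    deg≤card-support⇒multiplicityFree (outerBoundary-effective X)
      (subst (_≤ N) (sym deg-outer≡e) (≤-trans e≤k k≤N)) ,
    D~outer (≤-trans k≤N N≤e)

  via-D : (not ∘ X) ⊆ᵇ support (outerBoundary X) → N < + k →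
          MultiplicityFreeRepresentative G D
  via-D outside⊆N N<k = D , (D≥0 , D≤1) , ~-refl D
    where
    c : ℤ
    c = sumℤ (𝟙 (not ∘ X))
    K : ℤ
    K = + k - c + 1ℤ
    c<k : c < + k
    c<k = ≤-<-trans (sumℤ-mono-≤ (𝟙-mono {P = not ∘ X} {support (outerBoundary X)} outside⊆N)) N<k
    1≤c : 1ℤ ≤ c
    1≤c = subst (_≤ c) (cong (b2ℤ ∘ not) v∉X) (term≤sumℤ (b2ℤ-nonNeg ∘ not ∘ X) v)
    K≤neighboursIn : ∀ {w} → not (X w) ≡ true → K ≤ neighboursIn X w
    K≤neighboursIn {w} w∉X = begin
      + k - c + 1ℤ           ≤⟨ +-monoˡ-≤ 1ℤ (+-monoˡ-≤ (- c) κ≤p+q) ⟩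
      (p + q) - c + 1ℤ       ≡⟨ regroup p q c ⟩
      p + ((q + 1ℤ) - c)     ≤⟨ +-monoʳ-≤ p (i≤j⇒i-j≤0 (neighboursIn-<card {not ∘ X} w∉X)) ⟩
      p + 0ℤ                 ≡⟨ +-identityʳ p ⟩
      p                      ∎
      where
      open ≤-Reasoning
      p q : ℤ
      p = neighboursIn X w
      q = neighboursIn (not ∘ X) w
      κ≤p+q : + k ≤ p + q
      κ≤p+q = subst (+ k ≤_) (degree-split X w) (κ≤degree w)
      regroup : ∀ p q c → (p + q) - c + 1ℤ ≡ p + ((q + 1ℤ) - c)
      regroup = solve-∀
    Kc≤e : K * c ≤ e
    Kc≤e = subst₂ _≤_ (sym (*-distribˡ-sumℤ K (𝟙 (not ∘ X)))) deg-outer≡e (sumℤ-mono-≤ λ w →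
      subst (_≤ outerBoundary X w) (*-comm (𝟙 (not ∘ X) w) K)
        (b2ℤ*-mono-≤-if (not (X w)) K≤neighboursIn))
    c≡1 : c ≡ 1ℤ
    c≡1 = i-j≡0⇒i≡j c 1ℤ (i*j≤0⇒i≡0 (i≤j⇒0≤j-i 1≤c) (i<j⇒1≤j-i c<k)
            (subst (_≤ 0ℤ) (factor (+ k) c) (i≤j⇒i-j≤0 (≤-trans Kc≤e e≤k))))
      where
      factor : ∀ k c → (k - c + 1ℤ) * c - k ≡ (c - 1ℤ) * (k - c)
      factor = solve-∀
    k≤e : + k ≤ e
    k≤e = subst (_≤ e) (trans (cong (λ c → (+ k - c + 1ℤ) * c) c≡1) (simplify (+ k))) Kc≤e
      where
      simplify : ∀ k → (k - 1ℤ + 1ℤ) * 1ℤ ≡ k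
      simplify = solve-∀
    D≤1 : ∀ u → D u ≤ 1ℤ
    D≤1 u = begin
      D u                                ≡⟨ D≗inner k≤e u ⟩
      𝟙 X u * neighboursIn (not ∘ X) u   ≤⟨ b2ℤ*-≤ (X u) (neighboursIn-nonNeg (not ∘ X) u) ⟩
      neighboursIn (not ∘ X) u           ≤⟨ neighboursIn-≤card (not ∘ X) u ⟩
      c                                  ≡⟨ c≡1 ⟩
      1ℤ                                 ∎
      where open ≤-Reasoning

  multiplicityFreeRepresentative : MultiplicityFreeRepresentative G D
  multiplicityFreeRepresentative
    with any? (λ w → (X w ≟ᴮ false) ×-dec (support (outerBoundary X) w ≟ᴮ false))
  ... | yes (w , w∉X , w∉N) =
    via-outer (κ≤separator enclosed x∈X x∉N w∉X w∉N)
    where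
    x∉N : support (outerBoundary X) x ≡ false
    x∉N = support-0 {D = outerBoundary X} (cong (λ b → b2ℤ (not b) * neighboursIn X x) x∈X)
  ... | no ∄w with + k ≤? N
  ...   | yes k≤N = via-outer k≤N
  ...   | no  k≰N = via-D outside⊆N (≰⇒> k≰N)
    where
    outside⊆N : (not ∘ X) ⊆ᵇ support (outerBoundary X)
    outside⊆N {w} w∉X = ¬-not λ w∉N → ∄w (w , not-injective w∉X , w∉N)

∣vertexCut∣<n : ∀ {n} {G : Graph n} {S} → IsVertexCut G S → ∣ S ∣ ℕ.< n
∣vertexCut∣<n {n} {S = S} (inj₁ (u , _ , u∉S , _)) =
  subst (∣ S ∣ ℕ.<_) (∣⊤∣≡n n) (p⊂q⇒∣p∣<∣q∣ (⊆⊤ , u , ∈⊤ , u∉S))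
∣vertexCut∣<n {n} {S = S} (inj₂ ∣∁S∣≡1) =
  ℕ.m∸n≢0⇒n<m λ n∸∣S∣≡0 → ℕ.1+n≢0 (trans (sym ∣∁S∣≡1) (trans (∣∁p∣≡n∸∣p∣ S) n∸∣S∣≡0))

deg<n⇒∃zero : ∀ {n} {D : Divisor n} → Effective D → deg D < + n → ∃[ v ] D v ≡ 0ℤ
deg<n⇒∃zero {n} {D} D≥0 deg<n with any? (λ v → D v ≟ 0ℤ)
... | yes zero-of-D = zero-of-D
... | no  ∄zero     = ⊥-elim (<⇒≱ deg<n (subst (_≤ deg D) (sumℤ-one {n}) (sumℤ-mono-≤ 1≤D)))
  where
  1≤D : ∀ v → 1ℤ ≤ D v
  1≤D v = i<j⇒suc[i]≤j (≤∧≢⇒< (D≥0 v) λ 0≡Dv → ∄zero (v , sym 0≡Dv))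

multiplicityFree-from-firing : ∀ {n} {G : Graph n} {k : ℕ} →
  (∀ S → IsVertexCut G S → k ℕ.≤ ∣ S ∣) →
  ∀ {D₀ D₁ v} → Effective D₀ → deg D₀ ≡ + k → D₀ v ≡ 0ℤ →
  Effective D₁ → 1ℤ ≤ D₁ v → Equivalent G D₀ D₁ →
  MultiplicityFreeRepresentative G D₀
multiplicityFree-from-firing {G = G} κ≤cut {v = v} D₀≥0 degD₀≡k D₀v≡0 D₁≥0 1≤D₁v (F , D₀-D₁≡LF) =
  BoundedFiringSet.multiplicityFreeRepresentative G κ≤cut D₀≥0 degD₀≡k
    Top top∈Top (outside-Top D₀v≡0 1≤D₁v) innerBoundary≤D₀
  where open MaxLevelSet G D₀≥0 D₁≥0 F D₀-D₁≡LF v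

multiplicityFree-at-κ : ∀ {n} {G : Graph n} {k D} → IsVertexConnectivity G k →
  PositiveRank G D → deg D ≡ + k →
  ∃[ D* ] (MultiplicityFree D* × PositiveRank G D* × deg D* ≡ + k)
multiplicityFree-at-κ {n} {G} {k} {D} ((_ , S-cut , ∣S∣≡k) , κ≤cut)
                      rankD@(_ , _ , (D₀ , D~D₀ , D₀≥0) , _) degD≡k =
  transport (chip-at-zero (deg<n⇒∃zero D₀≥0 (subst (_< + n) (sym degD₀≡k) (+<+ k<n))))
  where
  open Laplacian G
  k<n : k ℕ.< n
  k<n = subst (ℕ._< n) ∣S∣≡k (∣vertexCut∣<n S-cut)
  degD₀≡k : deg D₀ ≡ + k
  degD₀≡k = trans (sym (deg-~ {D} {D₀} D~D₀)) degD≡k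
  chip-at-zero : ∃[ v ] D₀ v ≡ 0ℤ → MultiplicityFreeRepresentative G D₀
  chip-at-zero (v , D₀v≡0) with positiveRank⇒~chip-at {D = D} rankD v
  ... | D₁ , D₁≥0 , 1≤D₁v , D~D₁ = multiplicityFree-from-firing κ≤cut D₀≥0 degD₀≡k D₀v≡0 D₁≥0 1≤D₁v
                                     (~-trans {D₀} {D} {D₁} (~-sym {D} {D₀} D~D₀) D~D₁)
  transport : MultiplicityFreeRepresentative G D₀ →
              ∃[ D* ] (MultiplicityFree D* × PositiveRank G D* × deg D* ≡ + k)
  transport (D* , D*-mf , D₀~D*) =
    D* , D*-mf , positiveRank-~ {D} {D*} D~D* rankD , trans (sym (deg-~ {D} {D*} D~D*)) degD≡k
    where
    D~D* : Equivalent G D D*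
    D~D* = ~-trans {D} {D₀} {D*} D~D₀ D₀~D*

proposition3p2 : (n : ℕ) (G : Graph n) → Connected G →
                 (g : ℤ) (k : ℕ) → IsGon G g → IsVertexConnectivity G k →
                 g ≡ + k → IsMfgon G g
proposition3p2 n G _ g k ((D , rankD , degD≡g) , gon≤) κ g≡k =
  at-g (multiplicityFree-at-κ {G = G} {k} {D} κ rankD (trans degD≡g g≡k)) , λ D′ _ → gon≤ D′
  where
  at-g : ∃[ D* ] (MultiplicityFree D* × PositiveRank G D* × deg D* ≡ + k) →
         ∃[ D* ] (MultiplicityFree D* × PositiveRank G D* × deg D* ≡ g)
  at-g (D* , D*-mf , rankD* , degD*≡k) = D* , D*-mf , rankD* , trans degD*≡k (sym g≡k)
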